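{- If $M_{\mathfrak{X}}$ is even, then $M_{\mathfrak{X}'}$ is also even and \[ M_{\mathfrak{X}}>M_{\mathfrak{X}'}. \]
   Context: Let $n,m$ be positive integers, let $\{\mathbf{e}_1,\ldots,\mathbf{e}_{mn}\}$ be the standard basis of $\mathbb{R}^{mn}$, and let $\tilde{H}(n,m)=\{\sum_{i=1}^m \mathbf{e}_{(i-1)n+x_i} : (x_1,\ldots,x_m)\in\{1,\ldots,n\}^m\}$ (the Euclidean representation of the Hamming scheme $H(n,m)$); $d(\,,)$ denotes Euclidean distance. For real $x_i$ and natural numbers $\lambda_i$, $(x_1^{\lambda_1},\ldots,x_s^{\lambda_s})$ denotes the vector in which $x_i$ is repeated $\lambda_i$ times, and $\mathbf{v}^P$ denotes the set of all coordinate permutations of a vector $\mathbf{v}$. For each $j\in\{1,\ldots,m\}$ let $t_j$ be an integer with $1\le t_j\le m$ and let $k_1^{(j)},\ldots,k_{t_j}^{(j)}$ be nonnegative integers with $\sum_{i=1}^{t_j}k_i^{(j)}=n$ (here $k_{t_j}^{(j)}\ge 1$, i.e. $t_j$ is the number of levels actually used), and put $k_0^{(j)}=1+\sum_{i=1}^{t_j}(i-1)k_i^{(j)}$. Let \[ \mathfrak{x}_j=\Big(\tfrac{k_0^{(j)}}{n}^{k_1^{(j)}},\big(\tfrac{k_0^{(j)}}{n}-1\big)^{k_2^{(j)}},\ldots,\big(\tfrac{k_0^{(j)}}{n}-t_j+1\big)^{k_{t_j}^{(j)}}\Big)^P\subset\mathbb{R}^n, \] and $\mathfrak{X}=(\mathfrak{x}_1,\ldots,\mathfrak{x}_m)=\{(\mathbf{x}_1,\ldots,\mathbf{x}_m):\mathbf{x}_j\in\mathfrak{x}_j\}\subset\mathbb{R}^{mn}$,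 with parameters $k_i^{(j)}$. Define $M_{\mathfrak{X}}=\max_{\mathbf{y}\in\tilde{H}(n,m)}d(\mathbf{x},\mathbf{y})^2$ for $\mathbf{x}\in\mathfrak{X}$ (independent of the choice of $\mathbf{x}$); it equals \[ M_{\mathfrak{X}}=\sum_{j=1}^m\Big(1-n-2k_0^{(j)}-\frac{(k_0^{(j)})^2}{n}+\sum_{i=1}^{t_j}i^2k_i^{(j)}+2t_j\Big). \] Suppose $t_l\ge 3$ for some $l$. Define $\mathfrak{X}'$ as the set of the same form with parameters ${k'}_i^{(j)}$ given by: ${k'}_i^{(j)}=k_i^{(j)}$ for $(j,i)\ne(l,1),(l,2),(l,t_l-1),(l,t_l)$; if $t_l\ge4$: ${k'}_1^{(l)}=k_1^{(l)}-1$, ${k'}_2^{(l)}=k_2^{(l)}+1$, ${k'}_{t_l-1}^{(l)}=k_{t_l-1}^{(l)}+1$, ${k'}_{t_l}^{(l)}=k_{t_l}^{(l)}-1$; if $t_l=3$: ${k'}_1^{(l)}=k_1^{(l)}-1$, ${k'}_2^{(l)}=k_2^{(l)}+2$, ${k'}_3^{(l)}=k_3^{(l)}-1$. (The values $k_0^{(j)}$ are unchanged, and the new number of levels is $t_l'=t_l$ if $k_{t_l}^{(l)}\ge2$ and $t_l'=t_l-1$ if $k_{t_l}^{(l)}=1$.) -}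

module Defs where

open import Data.Nat as ℕ using (ℕ; zero; suc; _+_; _*_; _∸_; _≤_; _≡ᵇ_; NonZero)
open import Data.Integer as ℤ using (ℤ; +_)
open import Data.Rational as ℚ using (ℚ)
open import Data.Fin as Fin using (Fin)
open import Data.Bool using (Bool; true; false; if_then_else_)
open import Data.Product using (_×_; ∃-syntax)
open import Relation.Nullary using (does)
open import Relation.Binary.PropositionalEquality using (_≡_)

sum1to : ℕ → (ℕ → ℕ) → ℕ
sum1to zero    f = 0
sum1to (suc t) f = sum1to t f + f (suc t)

sumFinℚ : (m : ℕ) → (Fin m → ℚ) → ℚ
sumFinℚ zero    g = ℚ.0ℚ
sumFinℚ (suc m) g = g Fin.zero ℚ.+ sumFinℚ m (λ j → g (Fin.suc j))

-- Parameters of 𝔛: for every column j ∈ Fin m a number of levels t j and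
-- multiplicities k j i for i = 1 … t j (values of k j at other indices unused).

k0 : (t : ℕ) → (ℕ → ℕ) → ℕ
k0 t c = 1 + sum1to t (λ i → (i ∸ 1) * c i)

ℕtoℚ : ℕ → ℚ
ℕtoℚ a = (+ a) ℚ./ 1

Mcol : (n : ℕ) → .{{NonZero n}} → (t : ℕ) → (ℕ → ℕ) → ℚ
Mcol n t c =
  ((ℕtoℚ (1 + sum1to t (λ i → i * i * c i) + 2 * t)
     ℚ.- ℕtoℚ n)
     ℚ.- ℕtoℚ (2 * k0 t c))
     ℚ.- ((+ (k0 t c * k0 t c)) ℚ./ n)

M𝔛 : (n m : ℕ) → .{{NonZero n}} → (t : Fin m → ℕ) → (k : Fin m → ℕ → ℕ) → ℚ
M𝔛 n m t k = sumFinℚ m (λ j → Mcol n (t j) (k j))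

Admissible : (n m : ℕ) → (t : Fin m → ℕ) → (k : Fin m → ℕ → ℕ) → Set
Admissible n m t k =
  (j : Fin m) → (1 ≤ t j) × (t j ≤ m) × (sum1to (t j) (k j) ≡ n) × (1 ≤ k j (t j))

modCol : ℕ → (ℕ → ℕ) → ℕ → ℕ
modCol t c i =
  if t ≡ᵇ 3
  then (if i ≡ᵇ 1 then c i ∸ 1 else
        if i ≡ᵇ 2 then c i + 2 else
        if i ≡ᵇ 3 then c i ∸ 1 else c i)
  else (if i ≡ᵇ 1 then c i ∸ 1 else
        if i ≡ᵇ 2 then c i + 1 else
        if i ≡ᵇ (t ∸ 1) then c i + 1 else
        if i ≡ᵇ t then c i ∸ 1 else c i)

modT : ℕ → (ℕ → ℕ) → ℕ
modT t c = if c t ≡ᵇ 1 then t ∸ 1 else t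

k′ : {m : ℕ} → (t : Fin m → ℕ) → (k : Fin m → ℕ → ℕ) → Fin m → Fin m → ℕ → ℕ
k′ t k l j = if does (j Fin.≟ l) then modCol (t j) (k j) else k j

t′ : {m : ℕ} → (t : Fin m → ℕ) → (k : Fin m → ℕ → ℕ) → Fin m → Fin m → ℕ
t′ t k l j = if does (j Fin.≟ l) then modT (t j) (k j) else t j

Evenℚ : ℚ → Set
Evenℚ q = ∃[ z ] (q ≡ ((ℤ.+ 2) ℤ.* z) ℚ./ 1)

{-# OPTIONS --safe #-}
-- The modification of column l moves one unit of multiplicity from level 1 to level 2 and one
-- from level t to level t − 1 (both to level 2 when t = 3).  Testing this against the weights
-- i − 1 and i² shows that k₀ = 1 + Σ (i − 1) kᵢ is unchanged while Σ i² kᵢ drops by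
-- 1 + t² − 4 − (t − 1)² = 2(t − 2) > 0; if level t is emptied, dropping it lowers 2t by a
-- further 2.  Every other column is untouched, so M_𝔛 − M_𝔛' is a positive even integer.
module Submission where

open import Defs
open import Data.Nat using (ℕ; zero; suc; _+_; _*_; _∸_; _≤_; _≡ᵇ_; z≤n; s≤s; NonZero)
open import Data.Nat.Properties
  using (_≟_; ≤-refl; ≤-reflexive; n≤1+n; m≤n⇒m≤1+n; <⇒≢; ≤∧≢⇒<; m<1+n⇒m≤n; 1+n≢n; m+[n∸m]≡n;
         m∸n+n≡m; +-identityʳ; *-identityʳ; *-zeroʳ; +-cancelʳ-≡; *-distribˡ-+)
open import Data.Nat.Solver using (module +-*-Solver)
open import Data.Nat.Coprimality using (1-coprimeTo) renaming (sym to Coprime-sym)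
open import Data.Integer as ℤ using (ℤ; -[1+_])
import Data.Integer.Properties as ℤP
open import Data.Integer.Solver using () renaming (module +-*-Solver to ℤ-Solver)
open import Data.Rational as ℚ using (ℚ; mkℚ; _<_)
import Data.Rational.Properties as ℚP
open import Data.Rational.Solver using () renaming (module +-*-Solver to ℚ-Solver)
open import Algebra.Properties.Group ℚP.+-0-group using (∙-cancelʳ)
open import Data.Fin as Fin using (Fin)
import Data.Fin.Properties as FinP
open import Data.Bool using (true; false; if_then_else_)
open import Data.Product using (_×_; _,_; proj₁; proj₂; ∃-syntax)
open import Data.Sum using (_⊎_; inj₁; inj₂)
open import Function using (_∘_)
open import Relation.Nullary using (yes; no)
open import Relation.Nullary.Decidable using (dec-true; dec-false)
open import Relation.Binary.PropositionalEquality
open ≡-Reasoning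

≡⇒≡ᵇ-true : ∀ {m n} → m ≡ n → (m ≡ᵇ n) ≡ true
≡⇒≡ᵇ-true {m} {n} = dec-true (m ≟ n)

≢⇒≡ᵇ-false : ∀ {m n} → m ≢ n → (m ≡ᵇ n) ≡ false
≢⇒≡ᵇ-false {m} {n} = dec-false (m ≟ n)

δ : ℕ → ℕ → ℕ
δ a i = if i ≡ᵇ a then 1 else 0

δ-self : ∀ a → δ a a ≡ 1
δ-self a rewrite ≡⇒≡ᵇ-true {a} refl = refl

δ-≢ : ∀ {a i} → i ≢ a → δ a i ≡ 0
δ-≢ i≢a rewrite ≢⇒≡ᵇ-false i≢a = refl

sum1to-cong : ∀ t {f g : ℕ → ℕ} → (∀ i → f i ≡ g i) → sum1to t f ≡ sum1to t g
sum1to-cong zero    f≗g = refl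
sum1to-cong (suc t) f≗g = cong₂ _+_ (sum1to-cong t f≗g) (f≗g (suc t))

sum1to-vanish : ∀ t {f : ℕ → ℕ} → (∀ {i} → i ≤ t → f i ≡ 0) → sum1to t f ≡ 0
sum1to-vanish zero    f≗0 = refl
sum1to-vanish (suc t) f≗0 = cong₂ _+_ (sum1to-vanish t (f≗0 ∘ m≤n⇒m≤1+n)) (f≗0 ≤-refl)

sum1to-+ : ∀ t (f g : ℕ → ℕ) → sum1to t (λ i → f i + g i) ≡ sum1to t f + sum1to t g
sum1to-+ zero    f g = refl
sum1to-+ (suc t) f g = begin
  sum1to t (λ i → f i + g i) + (f (suc t) + g (suc t))
    ≡⟨ cong (_+ (f (suc t) + g (suc t))) (sum1to-+ t f g) ⟩
  sum1to t f + sum1to t g + (f (suc t) + g (suc t))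
    ≡⟨ solve 4 (λ a b x y → a :+ b :+ (x :+ y) := a :+ x :+ (b :+ y)) refl
               (sum1to t f) (sum1to t g) (f (suc t)) (g (suc t)) ⟩
  sum1to t f + f (suc t) + (sum1to t g + g (suc t)) ∎
  where open +-*-Solver

sum1to-*δ : ∀ {t a} (w : ℕ → ℕ) → 1 ≤ a → a ≤ t → sum1to t (λ i → w i * δ a i) ≡ w a
sum1to-*δ {zero}  {suc _} w _ ()
sum1to-*δ {suc t} {a} w 1≤a a≤1+t with a ≟ suc t
... | yes refl = begin
  sum1to t (λ i → w i * δ a i) + w a * δ a a
    ≡⟨ cong₂ _+_ (sum1to-vanish t λ {i} i≤t → trans (cong (w i *_) (δ-≢ (<⇒≢ (s≤s i≤t)))) (*-zeroʳ (w i)))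
                 (cong (w a *_) (δ-self a)) ⟩
  w a * 1
    ≡⟨ *-identityʳ (w a) ⟩
  w a ∎
... | no a≢1+t = begin
  sum1to t (λ i → w i * δ a i) + w (suc t) * δ a (suc t)
    ≡⟨ cong₂ _+_ (sum1to-*δ w 1≤a (m<1+n⇒m≤n (≤∧≢⇒< a≤1+t a≢1+t)))
                 (cong (w (suc t) *_) (δ-≢ (a≢1+t ∘ sym))) ⟩
  w a + w (suc t) * 0
    ≡⟨ cong (w a +_) (*-zeroʳ (w (suc t))) ⟩
  w a + 0
    ≡⟨ +-identityʳ (w a) ⟩
  w a ∎

sum1to-*[+δ+δ] : ∀ {t a b} (w f : ℕ → ℕ) → 1 ≤ a → a ≤ t → 1 ≤ b → b ≤ t →
  sum1to t (λ i → w i * (f i + (δ a i + δ b i))) ≡ sum1to t (λ i → w i * f i) + (w a + w b)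
sum1to-*[+δ+δ] {t} {a} {b} w f 1≤a a≤t 1≤b b≤t = begin
  sum1to t (λ i → w i * (f i + (δ a i + δ b i)))
    ≡⟨ sum1to-cong t (λ i → trans (*-distribˡ-+ (w i) _ _)
                                  (cong (w i * f i +_) (*-distribˡ-+ (w i) _ _))) ⟩
  sum1to t (λ i → w i * f i + (w i * δ a i + w i * δ b i))
    ≡⟨ sum1to-+ t _ _ ⟩
  sum1to t (λ i → w i * f i) + sum1to t (λ i → w i * δ a i + w i * δ b i)
    ≡⟨ cong (sum1to t (λ i → w i * f i) +_) (sum1to-+ t _ _) ⟩
  sum1to t (λ i → w i * f i) + (sum1to t (λ i → w i * δ a i) + sum1to t (λ i → w i * δ b i))
    ≡⟨ cong (sum1to t (λ i → w i * f i) +_) (cong₂ _+_ (sum1to-*δ w 1≤a a≤t) (sum1to-*δ w 1≤b b≤t)) ⟩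
  sum1to t (λ i → w i * f i) + (w a + w b) ∎

m∸1+1≡m+0 : ∀ {x} → 1 ≤ x → x ∸ 1 + 1 ≡ x + 0
m∸1+1≡m+0 {x} x≥1 = trans (m∸n+n≡m x≥1) (sym (+-identityʳ x))

modCol-balance : ∀ s c → 1 ≤ c 1 → 1 ≤ c (3 + s) →
  ∀ i → modCol (3 + s) c i + (δ 1 i + δ (3 + s) i) ≡ c i + (δ 2 i + δ (2 + s) i)
modCol-balance zero    c _    _    0 = refl
modCol-balance zero    c c₁≥1 _    1 = m∸1+1≡m+0 c₁≥1
modCol-balance zero    c _    _    2 = +-identityʳ _
modCol-balance zero    c _    c₃≥1 3 = m∸1+1≡m+0 c₃≥1
modCol-balance zero    c _    _    (suc (suc (suc (suc _)))) = refl
modCol-balance (suc s) c c₁≥1 cₜ≥1 i with i ≟ 1 | i ≟ 2 | i ≟ 3 + s | i ≟ 4 + s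
... | yes refl | _ | _ | _ = m∸1+1≡m+0 c₁≥1
... | no _ | yes refl | _ | _ = +-identityʳ _
... | no _ | no _ | yes refl | _
  rewrite ≡⇒≡ᵇ-true {s} refl | ≢⇒≡ᵇ-false {s} {suc s} (1+n≢n ∘ sym) = +-identityʳ _
... | no _ | no _ | no _ | yes refl
  rewrite ≡⇒≡ᵇ-true {s} refl | ≢⇒≡ᵇ-false {suc s} {s} 1+n≢n = m∸1+1≡m+0 cₜ≥1
... | no i≢1 | no i≢2 | no i≢t-1 | no i≢t
  rewrite ≢⇒≡ᵇ-false i≢1 | ≢⇒≡ᵇ-false i≢2 | ≢⇒≡ᵇ-false i≢t-1 | ≢⇒≡ᵇ-false i≢t = refl

sum1to-*modCol : ∀ s c (w : ℕ → ℕ) → 1 ≤ c 1 → 1 ≤ c (3 + s) →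
  sum1to (3 + s) (λ i → w i * modCol (3 + s) c i) + (w 1 + w (3 + s))
    ≡ sum1to (3 + s) (λ i → w i * c i) + (w 2 + w (2 + s))
sum1to-*modCol s c w c₁≥1 cₜ≥1 = begin
  sum1to (3 + s) (λ i → w i * modCol (3 + s) c i) + (w 1 + w (3 + s))
    ≡⟨ sym (sum1to-*[+δ+δ] w (modCol (3 + s) c) (s≤s z≤n) (s≤s z≤n) (s≤s z≤n) ≤-refl) ⟩
  sum1to (3 + s) (λ i → w i * (modCol (3 + s) c i + (δ 1 i + δ (3 + s) i)))
    ≡⟨ sum1to-cong (3 + s) (λ i → cong (w i *_) (modCol-balance s c c₁≥1 cₜ≥1 i)) ⟩
  sum1to (3 + s) (λ i → w i * (c i + (δ 2 i + δ (2 + s) i)))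
    ≡⟨ sum1to-*[+δ+δ] w c (s≤s z≤n) (s≤s (s≤s z≤n)) (s≤s z≤n) (n≤1+n (2 + s)) ⟩
  sum1to (3 + s) (λ i → w i * c i) + (w 2 + w (2 + s)) ∎

k0-modCol : ∀ s c → 1 ≤ c 1 → 1 ≤ c (3 + s) → k0 (3 + s) (modCol (3 + s) c) ≡ k0 (3 + s) c
k0-modCol s c c₁≥1 cₜ≥1 = cong suc (+-cancelʳ-≡ (2 + s) _ _ (sum1to-*modCol s c (λ i → i ∸ 1) c₁≥1 cₜ≥1))

sumSq-modCol : ∀ s c → 1 ≤ c 1 → 1 ≤ c (3 + s) →
  sum1to (3 + s) (λ i → i * i * c i) ≡ sum1to (3 + s) (λ i → i * i * modCol (3 + s) c i) + 2 * (1 + s)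
sumSq-modCol s c c₁≥1 cₜ≥1 = +-cancelʳ-≡ (4 + (2 + s) * (2 + s)) _ _ (begin
  sum1to (3 + s) (λ i → i * i * c i) + (4 + (2 + s) * (2 + s))
    ≡⟨ sym (sum1to-*modCol s c (λ i → i * i) c₁≥1 cₜ≥1) ⟩
  S′ + (1 + (3 + s) * (3 + s))
    ≡⟨ solve 2 (λ S′ s → S′ :+ (con 1 :+ (con 3 :+ s) :* (con 3 :+ s))
                      := S′ :+ con 2 :* (con 1 :+ s) :+ (con 4 :+ (con 2 :+ s) :* (con 2 :+ s))) refl S′ s ⟩
  S′ + 2 * (1 + s) + (4 + (2 + s) * (2 + s)) ∎)
  where
  open +-*-Solver
  S′ = sum1to (3 + s) (λ i → i * i * modCol (3 + s) c i)

modCol-top : ∀ s c → modCol (3 + s) c (3 + s) ≡ c (3 + s) ∸ 1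
modCol-top zero    c = refl
modCol-top (suc s) c rewrite ≢⇒≡ᵇ-false (1+n≢n {s}) | ≡⇒≡ᵇ-true {s} refl = refl

modT-cases : ∀ t c → modT (suc t) c ≡ suc t ⊎ (modT (suc t) c ≡ t × c (suc t) ≡ 1)
modT-cases t c with c (suc t) ≟ 1
... | yes cₜ≡1 rewrite ≡⇒≡ᵇ-true cₜ≡1 = inj₂ (refl , cₜ≡1)
... | no  cₜ≢1 rewrite ≢⇒≡ᵇ-false cₜ≢1 = inj₁ refl

modT-≤ : ∀ t c → modT (suc t) c ≤ suc t
modT-≤ t c with modT-cases t c
... | inj₁ tₘ≡t       = ≤-reflexive tₘ≡t
... | inj₂ (tₘ≡t-1 , _) = subst (_≤ suc t) (sym tₘ≡t-1) (n≤1+n t)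

sum1to-modT : ∀ t c {f : ℕ → ℕ} → (c (suc t) ≡ 1 → f (suc t) ≡ 0) →
  sum1to (modT (suc t) c) f ≡ sum1to (suc t) f
sum1to-modT t c {f} f-top with modT-cases t c
... | inj₁ tₘ≡t = cong (λ u → sum1to u f) tₘ≡t
... | inj₂ (tₘ≡t-1 , cₜ≡1) = begin
  sum1to (modT (suc t) c) f ≡⟨ cong (λ u → sum1to u f) tₘ≡t-1 ⟩
  sum1to t f                ≡⟨ sym (+-identityʳ _) ⟩
  sum1to t f + 0            ≡⟨ cong (sum1to t f +_) (sym (f-top cₜ≡1)) ⟩
  sum1to (suc t) f          ∎

fromℤ : ℤ → ℚ
fromℤ z = z ℚ./ 1

fromℤ-mkℚ : ∀ z → fromℤ z ≡ mkℚ z 0 (Coprime-sym (1-coprimeTo ℤ.∣ z ∣))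
fromℤ-mkℚ (ℤ.+ n)    = ℚP.normalize-coprime (Coprime-sym (1-coprimeTo n))
fromℤ-mkℚ -[1+ n ] = cong ℚ.-_ (ℚP.normalize-coprime (Coprime-sym (1-coprimeTo (suc n))))

fromℤ-+ : ∀ a b → fromℤ (a ℤ.+ b) ≡ fromℤ a ℚ.+ fromℤ b
fromℤ-+ a b rewrite fromℤ-mkℚ a | fromℤ-mkℚ b =
  sym (cong₂ (λ x y → fromℤ (x ℤ.+ y)) (ℤP.*-identityʳ a) (ℤP.*-identityʳ b))

ℕtoℚ-+ : ∀ a b → ℕtoℚ (a + b) ≡ ℕtoℚ a ℚ.+ ℕtoℚ b
ℕtoℚ-+ a b = fromℤ-+ (ℤ.+ a) (ℤ.+ b)

Evenℚ-cancel-even : ∀ q e → Evenℚ (q ℚ.+ ℕtoℚ (2 * e)) → Evenℚ q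
Evenℚ-cancel-even q e (z , q+2e≡2z) = y , ∙-cancelʳ (ℕtoℚ (2 * e)) q _ (begin
  q ℚ.+ ℕtoℚ (2 * e)                    ≡⟨ q+2e≡2z ⟩
  fromℤ (ℤ.+ 2 ℤ.* z)                   ≡⟨ cong fromℤ 2z≡2y+2e ⟩
  fromℤ (ℤ.+ 2 ℤ.* y ℤ.+ ℤ.+ (2 * e))   ≡⟨ fromℤ-+ (ℤ.+ 2 ℤ.* y) (ℤ.+ (2 * e)) ⟩
  fromℤ (ℤ.+ 2 ℤ.* y) ℚ.+ ℕtoℚ (2 * e)  ∎)
  where
  open ℤ-Solver
  y = z ℤ.- ℤ.+ e
  2z≡2y+2e : ℤ.+ 2 ℤ.* z ≡ ℤ.+ 2 ℤ.* y ℤ.+ ℤ.+ (2 * e)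
  2z≡2y+2e = trans
    (solve 2 (λ z e → con (ℤ.+ 2) :* z := con (ℤ.+ 2) :* (z :- e) :+ con (ℤ.+ 2) :* e) refl z (ℤ.+ e))
    (cong (ℤ._+_ (ℤ.+ 2 ℤ.* y)) (sym (ℤP.pos-* 2 e)))

<-+ℕtoℚ : ∀ q d .{{_ : NonZero d}} → q < q ℚ.+ ℕtoℚ d
<-+ℕtoℚ q d = subst (_< q ℚ.+ ℕtoℚ d) (ℚP.+-identityʳ q)
  (ℚP.+-monoʳ-< q (ℚP.positive⁻¹ (ℕtoℚ d) {{ℚP.normalize-pos d 1}}))

Mcol-shift : ∀ n .{{_ : NonZero n}} t c tₘ cₘ d →
  1 + sum1to t (λ i → i * i * c i) + 2 * t ≡ 1 + sum1to tₘ (λ i → i * i * cₘ i) + 2 * tₘ + d →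
  k0 t c ≡ k0 tₘ cₘ →
  Mcol n t c ≡ Mcol n tₘ cₘ ℚ.+ ℕtoℚ d
Mcol-shift n t c tₘ cₘ d X≡Xₘ+d K≡Kₘ = begin
  Mcol n t c
    ≡⟨ cong₂ (λ x K → value (ℕtoℚ x) K) X≡Xₘ+d K≡Kₘ ⟩
  value (ℕtoℚ (Xₘ + d)) Kₘ
    ≡⟨ cong (λ x → value x Kₘ) (ℕtoℚ-+ Xₘ d) ⟩
  value (ℕtoℚ Xₘ ℚ.+ ℕtoℚ d) Kₘ
    ≡⟨ solve 5 (λ x d N A B → x :+ d :- N :- A :- B := x :- N :- A :- B :+ d) refl
               (ℕtoℚ Xₘ) (ℕtoℚ d) (ℕtoℚ n) (ℕtoℚ (2 * Kₘ)) ((ℤ.+ (Kₘ * Kₘ)) ℚ./ n) ⟩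
  Mcol n tₘ cₘ ℚ.+ ℕtoℚ d ∎
  where
  open ℚ-Solver
  Xₘ = 1 + sum1to tₘ (λ i → i * i * cₘ i) + 2 * tₘ
  Kₘ = k0 tₘ cₘ
  value : ℚ → ℕ → ℚ
  value x K = ((x ℚ.- ℕtoℚ n) ℚ.- ℕtoℚ (2 * K)) ℚ.- (ℤ.+ (K * K)) ℚ./ n

Mcol-modCol : ∀ n .{{_ : NonZero n}} t c → 3 ≤ t → 1 ≤ c 1 → 1 ≤ c t →
  ∃[ e ] (Mcol n t c ≡ Mcol n (modT t c) (modCol t c) ℚ.+ ℕtoℚ (2 * suc e))
Mcol-modCol n t c (s≤s (s≤s (s≤s (z≤n {s})))) c₁≥1 cₜ≥1 = s + u , Mcol-shift n t c tₘ cₘ _ X≡Xₘ+d K≡Kₘ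
  where
  open +-*-Solver
  tₘ = modT t c
  cₘ = modCol t c
  u = t ∸ tₘ
  tₘ+u≡t : tₘ + u ≡ t
  tₘ+u≡t = m+[n∸m]≡n (modT-≤ (2 + s) c)
  trim : ∀ (w : ℕ → ℕ) → sum1to tₘ (λ i → w i * cₘ i) ≡ sum1to t (λ i → w i * cₘ i)
  trim w = sum1to-modT (2 + s) c λ cₜ≡1 →
    trans (cong (w t *_) (trans (modCol-top s c) (cong (_∸ 1) cₜ≡1))) (*-zeroʳ (w t))
  S′ = sum1to t (λ i → i * i * cₘ i)
  X≡Xₘ+d : 1 + sum1to t (λ i → i * i * c i) + 2 * t
         ≡ 1 + sum1to tₘ (λ i → i * i * cₘ i) + 2 * tₘ + 2 * suc (s + u)
  X≡Xₘ+d = begin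
    1 + sum1to t (λ i → i * i * c i) + 2 * t
      ≡⟨ cong₂ (λ x y → 1 + x + 2 * y) (sumSq-modCol s c c₁≥1 cₜ≥1) (sym tₘ+u≡t) ⟩
    1 + (S′ + 2 * (1 + s)) + 2 * (tₘ + u)
      ≡⟨ solve 4 (λ S′ s tₘ u → con 1 :+ (S′ :+ con 2 :* (con 1 :+ s)) :+ con 2 :* (tₘ :+ u)
                            := con 1 :+ S′ :+ con 2 :* tₘ :+ con 2 :* (con 1 :+ (s :+ u))) refl S′ s tₘ u ⟩
    1 + S′ + 2 * tₘ + 2 * suc (s + u)
      ≡⟨ cong (λ x → 1 + x + 2 * tₘ + 2 * suc (s + u)) (sym (trim (λ i → i * i))) ⟩
    1 + sum1to tₘ (λ i → i * i * cₘ i) + 2 * tₘ + 2 * suc (s + u) ∎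
  K≡Kₘ : k0 t c ≡ k0 tₘ cₘ
  K≡Kₘ = trans (sym (k0-modCol s c c₁≥1 cₜ≥1)) (cong suc (sym (trim (λ i → i ∸ 1))))

sumFinℚ-cong : ∀ m {g h : Fin m → ℚ} → (∀ j → g j ≡ h j) → sumFinℚ m g ≡ sumFinℚ m h
sumFinℚ-cong zero    g≗h = refl
sumFinℚ-cong (suc m) g≗h = cong₂ ℚ._+_ (g≗h Fin.zero) (sumFinℚ-cong m (g≗h ∘ Fin.suc))

sumFinℚ-update : ∀ m {g h : Fin m → ℚ} l d → (∀ j → j ≢ l → g j ≡ h j) → g l ≡ h l ℚ.+ d →
  sumFinℚ m g ≡ sumFinℚ m h ℚ.+ d
sumFinℚ-update (suc m) {g} {h} Fin.zero d g≗h gₗ≡hₗ+d = begin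
  g Fin.zero ℚ.+ sumFinℚ m (g ∘ Fin.suc)
    ≡⟨ cong₂ ℚ._+_ gₗ≡hₗ+d (sumFinℚ-cong m (λ j → g≗h (Fin.suc j) λ ())) ⟩
  (h Fin.zero ℚ.+ d) ℚ.+ sumFinℚ m (h ∘ Fin.suc)
    ≡⟨ solve 3 (λ x d y → (x :+ d) :+ y := (x :+ y) :+ d) refl (h Fin.zero) d (sumFinℚ m (h ∘ Fin.suc)) ⟩
  (h Fin.zero ℚ.+ sumFinℚ m (h ∘ Fin.suc)) ℚ.+ d ∎
  where open ℚ-Solver
sumFinℚ-update (suc m) {g} {h} (Fin.suc l) d g≗h gₗ≡hₗ+d = begin
  g Fin.zero ℚ.+ sumFinℚ m (g ∘ Fin.suc)
    ≡⟨ cong₂ ℚ._+_ (g≗h Fin.zero λ ())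
                   (sumFinℚ-update m l d (λ j j≢l → g≗h (Fin.suc j) (j≢l ∘ FinP.suc-injective)) gₗ≡hₗ+d) ⟩
  h Fin.zero ℚ.+ (sumFinℚ m (h ∘ Fin.suc) ℚ.+ d)
    ≡⟨ sym (ℚP.+-assoc (h Fin.zero) (sumFinℚ m (h ∘ Fin.suc)) d) ⟩
  (h Fin.zero ℚ.+ sumFinℚ m (h ∘ Fin.suc)) ℚ.+ d ∎

module _ (n : ℕ) .{{_ : NonZero n}} {m} (t : Fin m → ℕ) (k : Fin m → ℕ → ℕ) where

  Mcol-t′k′-≢ : ∀ {l j} → j ≢ l → Mcol n (t′ t k l j) (k′ t k l j) ≡ Mcol n (t j) (k j)
  Mcol-t′k′-≢ {l} {j} j≢l = cong (λ b → Mcol n (if b then modT (t j) (k j) else t j)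
                                              (if b then modCol (t j) (k j) else k j))
                                 (dec-false (j Fin.≟ l) j≢l)

  Mcol-t′k′-self : ∀ l → Mcol n (t′ t k l l) (k′ t k l l) ≡ Mcol n (modT (t l) (k l)) (modCol (t l) (k l))
  Mcol-t′k′-self l = cong (λ b → Mcol n (if b then modT (t l) (k l) else t l)
                                         (if b then modCol (t l) (k l) else k l))
                          (dec-true (l Fin.≟ l) refl)

lemma4p2 : (n m : ℕ) → .{{_ : NonZero n}} →
    (t : Fin m → ℕ) → (k : Fin m → ℕ → ℕ) →
    Admissible n m t k →
    (l : Fin m) → 3 ≤ t l → 1 ≤ k l 1 →
    Evenℚ (M𝔛 n m t k) →
    Evenℚ (M𝔛 n m (t′ t k l) (k′ t k l))
      × (M𝔛 n m (t′ t k l) (k′ t k l) < M𝔛 n m t k)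
lemma4p2 n m t k admissible l tₗ≥3 kₗ₁≥1 M-even =
  Evenℚ-cancel-even M′ (suc e) (subst Evenℚ M≡M′+d M-even) ,
  subst (M′ <_) (sym M≡M′+d) (<-+ℕtoℚ M′ (2 * suc e))
  where
  M′ = M𝔛 n m (t′ t k l) (k′ t k l)
  column-l = Mcol-modCol n (t l) (k l) tₗ≥3 kₗ₁≥1 (proj₂ (proj₂ (proj₂ (admissible l))))
  e = proj₁ column-l
  M≡M′+d : M𝔛 n m t k ≡ M′ ℚ.+ ℕtoℚ (2 * suc e)
  M≡M′+d = sumFinℚ-update m l _ (λ j j≢l → sym (Mcol-t′k′-≢ n t k j≢l))
             (trans (proj₂ column-l) (cong (ℚ._+ ℕtoℚ (2 * suc e)) (sym (Mcol-t′k′-self n t k l))))
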